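{- Let $\mathbf{t}$ be the Tribonacci word and $F_k=|\varphi^k(0)|$. For $i\in\mathbb{N}$ let $N_i$ be the positive integer whose normal $F$-representation is $((1,0,0,0)^i,1)$, i.e. $i$ copies of the block $(1,0,0,0)$ followed by a final digit $1$; thus $N_i=\sum_{j=0}^{i}F_{4j}$. Then for all $i\ge2$, $$\mathcal{P}^{\mathrm{rel}}_{\mathbf{t}}(N_i)=\{(0,0,0),(-1,1,0),(-1,0,1),(0,-1,1),(0,1,-1)\},$$ and therefore $\mathrm{AC}_{\mathbf{t}}(N_i)=5$ for all $i\ge 2$. Consequently, the abelian complexity of the Tribonacci word attains the value $5$ infinitely many times.
   Context: The Tribonacci word $\mathbf{t}=\lim_{k\to\infty}\varphi^k(0)$ is the fixed point of the substitution $\varphi$ on $\{0,1,2\}^*$ given by $0\mapsto 01$, $1\mapsto 02$, $2\mapsto 0$; $F_k=|\varphi^k(0)|$. The normal $F$-representation of $n\in\mathbb{N}_0$ is the digit string $(d_N,\dots,d_0)$ with $n=\sum_i d_iF_i$ obtained by the greedy algorithm: choose $N$ with $n<F_{N+1}$, set $x_N=n$, and for $i=N,\dots,0$ put $d_i=\lfloor x_i/F_i\rfloor$, $x_{i-1}=x_i-d_iF_i$. For a finite word $w$, $\Psi(w)=(|w|_0,|w|_1,|w|_2)$ is its Parikh vector ($|w|_\ell$ = number of occurrences of $\ell$ in $w$). Let $\mathbf{t}_{[n]}$ denote the prefix of $\mathbf{t}$ of length $n$. For a factor $w$ of $\mathbf{t}$ of length $n$, its relative Parikh vector is $\Psi^{\mathrm{rel}}(w)=\Psi(w)-\Psi(\mathbf{t}_{[n]})$,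 and $\mathcal{P}^{\mathrm{rel}}_{\mathbf{t}}(n)=\{\Psi^{\mathrm{rel}}(w): w \text{ a factor of }\mathbf{t},\ |w|=n\}$. The abelian complexity is $\mathrm{AC}_{\mathbf{t}}(n)=\#\{\Psi(w): w\text{ a factor of }\mathbf{t},\ |w|=n\}$. -}

module Defs where

open import Data.Nat using (ℕ; zero; suc; _+_)
open import Data.Fin using (Fin; zero; suc)
open import Data.Fin.Properties using (_≟_)
open import Data.List using (List; []; _∷_; concatMap; length; filter; map; upTo; lookup)
open import Data.List.Relation.Unary.Unique.Propositional using (Unique)
open import Data.List.Membership.Propositional using (_∈_)
open import Data.Integer using (ℤ; +_; _-_)
open import Data.Product using (_×_; _,_; ∃; ∃-syntax)
open import Function.Bundles using (_⇔_)
open import Relation.Binary.PropositionalEquality using (_≡_)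

Letter : Set
Letter = Fin 3

φ : Letter → List Letter
φ zero             = zero ∷ suc zero ∷ []
φ (suc zero)       = zero ∷ suc (suc zero) ∷ []
φ (suc (suc zero)) = zero ∷ []

φ* : List Letter → List Letter
φ* = concatMap φ

φ^_[0] : ℕ → List Letter
φ^ zero  [0] = zero ∷ []
φ^ suc k [0] = φ* (φ^ k [0])

F : ℕ → ℕ
F k = length (φ^ k [0])

nth : {A : Set} → A → List A → ℕ → A
nth d []       _       = d
nth d (x ∷ xs) zero    = x
nth d (x ∷ xs) (suc n) = nth d xs n

-- The Tribonacci word t = lim φ^k(0), as a function ℕ → Letter (0-indexed).
-- φ^k(0) is a prefix of φ^(k+1)(0) and |φ^(n+1)(0)| > n, so the n-th
-- letter of t is the n-th letter of φ^(n+1)(0) (the default is never used).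
t : ℕ → Letter
t n = nth zero (φ^ suc n [0]) n

factor : ℕ → ℕ → List Letter
factor m n = map (λ j → t (m + j)) (upTo n)

prefix : ℕ → List Letter
prefix n = factor 0 n

count : Letter → List Letter → ℕ
count ℓ w = length (filter (_≟ ℓ) w)

Ψ : List Letter → ℕ × ℕ × ℕ
Ψ w = count zero w , count (suc zero) w , count (suc (suc zero)) w

Ψrel : ℕ → ℕ → ℤ × ℤ × ℤ
Ψrel m n with Ψ (factor m n) | Ψ (prefix n)
... | (a , b , c) | (a' , b' , c') = ((+ a) - (+ a')) , ((+ b) - (+ b')) , ((+ c) - (+ c'))

-- Membership in P^rel_t(n): v is the relative Parikh vector of some factor of length n
-- (every factor of t of length n is factor m n for some m).
_∈Prel_ : ℤ × ℤ × ℤ → ℕ → Set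
v ∈Prel n = ∃[ m ] Ψrel m n ≡ v

AC_≡_ : ℕ → ℕ → Set
AC n ≡ k = ∃[ L ] (length L ≡ k × Unique L ×
             (∀ (v : ℕ × ℕ × ℕ) → (v ∈ L) ⇔ (∃[ m ] Ψ (factor m n) ≡ v)))

N : ℕ → ℕ
N zero    = F 0
N (suc i) = N i + F (4 * suc i)
  where open import Data.Nat using (_*_)

module Submission where

-- The theorem is reduced to finite computations about a "shift transducer".
--
-- For the factor w = t[m,m+n) one has Ψrel(w) = D n m := Ψ(t[n,n+m)) - Ψ(t[0,m)) (`Ψrel≡D`), so
-- P^rel(n) is the set of values of D n ·.  As t = φ(t), the image of t[p,p+j) occurs in t at
-- position A p = |φ(t[0,p))|.  Consequently the configuration at shift n = bit d + A p and position
-- k -- the vector D n k with the next four letters of t[n+k,…) and of t[k,…) -- is a fixed function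
-- `next` of a configuration at shift p and an earlier position (`config-step`).  So a finite list
-- containing all configurations at shift p yields one for shift bit d + A p (`step-invariant`).
-- Since N_{i+1} = 1 + A(A(A(A N_i))) (`N′≡N`), a finite list U closed under this period contains all
-- configurations at the shifts N_i, i ≥ 2 (`invariant-N′`); its vectors lie in S₅ (upper bound).
-- Conversely the windows of length 177 at N_i stabilise for i ≥ 2, and the positions 0, 1, 3, 15,
-- 177 realise the five vectors (lower bound).  Finally relative Parikh vectors of factors of equal
-- length determine their Parikh vectors, which turns the description of P^rel(N_i) into the value
-- of the abelian complexity (`Prel-exact`, `AC-exact`).  All finite facts are checked by evaluating
-- decision procedures.

open import Defs
open import Data.Bool using (Bool; true; false)
open import Data.Fin using (zero; suc)
import Data.Fin.Properties as Finₚ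
open import Data.Integer as ℤ using (ℤ; +_; -[1+_])
import Data.Integer.Properties as ℤₚ
open import Data.Integer.Tactic.RingSolver using (solve-∀)
open import Data.List using (List; []; _∷_; _++_; length; take; drop; map; applyUpTo; head; deduplicate)
open import Data.List.Properties using (concatMap-++; ++-identityʳ; ++-assoc; length-++; map-upTo; ++-cancelˡ; take++drop≡id;
    map-cong-local; map-∘; length-map)
  renaming (≡-dec to List-≡-dec)
open import Data.List.Membership.Propositional using (_∈_)
open import Data.List.Membership.Propositional.Properties using (∈-deduplicate⁺; ∈-map⁺; ∈-map⁻)
open import Data.List.Relation.Unary.All as All using (All; all?)
open import Data.List.Relation.Unary.Any using (here; there)
open import Data.List.Relation.Unary.Unique.Propositional using (Unique)
import Data.List.Relation.Unary.Unique.Propositional.Properties as Uniqueₚ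
open import Data.Maybe.Properties using (just-injective)
open import Data.Nat using (ℕ; zero; suc; _+_; _*_; _∸_; _⊔_; _≤_; _<_; s≤s; z≤n; _≤?_; _/_; _%_)
open import Data.Nat.Induction using (<-rec)
open import Data.Nat.Properties
import Data.Nat.Tactic.RingSolver as ℕ-Solver
open import Data.Product using (_×_; _,_; ∃-syntax; proj₁; proj₂)
open import Data.Product.Properties using () renaming (≡-dec to ×-≡-dec)
open import Data.Sum using (_⊎_; inj₁; inj₂)
open import Data.Unit using (⊤; tt)
open import Function.Base using (_∘_)
open import Function.Bundles using (_⇔_; mk⇔)
open import Relation.Binary.Definitions using (DecidableEquality)
open import Relation.Nullary.Decidable using (Dec; yes; toWitness; _×-dec_)
open import Relation.Binary.PropositionalEquality

φ*-++ : ∀ xs ys → φ* (xs ++ ys) ≡ φ* xs ++ φ* ys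
φ*-++ = concatMap-++ φ

φ*-nonempty : ∀ w → 1 ≤ length w → 1 ≤ length (φ* w)
φ*-nonempty (zero ∷ w)             _ = s≤s z≤n
φ*-nonempty (suc zero ∷ w)         _ = s≤s z≤n
φ*-nonempty (suc (suc zero) ∷ w)   _ = s≤s z≤n

φ^-extends : ∀ k → ∃[ r ] (φ^ suc k [0] ≡ φ^ k [0] ++ r) × 1 ≤ length r
φ^-extends zero = suc zero ∷ [] , refl , s≤s z≤n
φ^-extends (suc k) with φ^-extends k
... | r , eq , r-nonempty =
  φ* r , trans (cong φ* eq) (φ*-++ (φ^ k [0]) r) , φ*-nonempty r r-nonempty

φ^-prefix : ∀ k d → ∃[ r ] φ^ (d + k) [0] ≡ φ^ k [0] ++ r
φ^-prefix k zero    = [] , sym (++-identityʳ _)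
φ^-prefix k (suc d) with φ^-prefix k d | φ^-extends (d + k)
... | r , eq | r′ , eq′ , _ =
  r ++ r′ , trans eq′ (trans (cong (_++ r′) eq) (++-assoc (φ^ k [0]) r r′))

F-grow : ∀ k → k < F k
F-grow zero = s≤s z≤n
F-grow (suc k) with φ^-extends k
... | r , eq , r-nonempty = begin-strict
  suc k                   ≤⟨ F-grow k ⟩
  F k                     <⟨ m<m+n (F k) r-nonempty ⟩
  F k + length r          ≡⟨ sym (length-++ (φ^ k [0])) ⟩
  length (φ^ k [0] ++ r)  ≡⟨ cong length (sym eq) ⟩
  F (suc k)               ∎
  where open ≤-Reasoning

nth-++ˡ : ∀ {A : Set} (d : A) xs ys {i} → i < length xs → nth d (xs ++ ys) i ≡ nth d xs i
nth-++ˡ d (x ∷ xs) ys {zero}  _         = refl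
nth-++ˡ d (x ∷ xs) ys {suc i} (s≤s i<) = nth-++ˡ d xs ys i<

nth-φ^-stable : ∀ {k K n} → k ≤ K → n < F k → nth zero (φ^ K [0]) n ≡ nth zero (φ^ k [0]) n
nth-φ^-stable {k} {K} {n} k≤K n<F with φ^-prefix k (K ∸ k)
... | r , eq = begin
  nth zero (φ^ K [0]) n                  ≡⟨ cong (λ z → nth zero (φ^ z [0]) n) (sym (m∸n+n≡m k≤K)) ⟩
  nth zero (φ^ (K ∸ k + k) [0]) n        ≡⟨ cong (λ z → nth zero z n) eq ⟩
  nth zero (φ^ k [0] ++ r) n             ≡⟨ nth-++ˡ zero (φ^ k [0]) r n<F ⟩
  nth zero (φ^ k [0]) n                  ∎
  where open ≡-Reasoning

t-from-φ^ : ∀ K n → n < F K → t n ≡ nth zero (φ^ K [0]) n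
t-from-φ^ K n n<F with ≤-total K (suc n)
... | inj₁ K≤ = nth-φ^-stable K≤ n<F
... | inj₂ ≤K = sym (nth-φ^-stable ≤K (<-trans (n<1+n n) (F-grow (suc n))))

W : ℕ → ℕ → List Letter
W q zero    = []
W q (suc m) = t q ∷ W (suc q) m

length-W : ∀ q m → length (W q m) ≡ m
length-W q zero    = refl
length-W q (suc m) = cong suc (length-W (suc q) m)

W-++ : ∀ q a b → W q (a + b) ≡ W q a ++ W (q + a) b
W-++ q zero    b = cong (λ z → W z b) (sym (+-identityʳ q))
W-++ q (suc a) b = cong (t q ∷_) (trans (W-++ (suc q) a b) (cong (λ z → W (suc q) a ++ W z b) (sym (+-suc q a))))

take-W : ∀ q {a b} → a ≤ b → take a (W q b) ≡ W q a
take-W q {zero}  _         = refl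
take-W q {suc a} (s≤s a≤b) = cong (t q ∷_) (take-W (suc q) a≤b)

drop-W : ∀ q {a b} → a ≤ b → drop a (W q b) ≡ W (q + a) (b ∸ a)
drop-W q {zero}  {b}     _         = cong (λ z → W z b) (sym (+-identityʳ q))
drop-W q {suc a} {suc b} (s≤s a≤b) = trans (drop-W (suc q) a≤b) (cong (λ z → W z (b ∸ a)) (sym (+-suc q a)))

nth-W : ∀ q {i b} → i < b → nth zero (W q b) i ≡ t (q + i)
nth-W q {zero}  {suc b} _         = cong t (sym (+-identityʳ q))
nth-W q {suc i} {suc b} (s≤s i<b) = trans (nth-W (suc q) i<b) (cong t (sym (+-suc q i)))

W-φ^ : ∀ K q m → q + m ≤ F K → W q m ≡ take m (drop q (φ^ K [0]))
W-φ^ K q m q+m≤ = go q m q+m≤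
  where
  drop-nth : ∀ (xs : List Letter) q → q < length xs → drop q xs ≡ nth zero xs q ∷ drop (suc q) xs
  drop-nth (x ∷ xs) zero    _         = refl
  drop-nth (x ∷ xs) (suc q) (s≤s q<) = drop-nth xs q q<
  go : ∀ q m → q + m ≤ F K → W q m ≡ take m (drop q (φ^ K [0]))
  go q zero    _  = refl
  go q (suc m) le = begin
    t q ∷ W (suc q) m                                        ≡⟨ cong₂ _∷_ (t-from-φ^ K q q<F) (go (suc q) m (subst (_≤ F K) (+-suc q m) le)) ⟩
    nth zero (φ^ K [0]) q ∷ take m (drop (suc q) (φ^ K [0])) ≡⟨ cong (take (suc m)) (sym (drop-nth (φ^ K [0]) q q<F)) ⟩
    take (suc m) (drop q (φ^ K [0]))                         ∎
    where
    open ≡-Reasoning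
    q<F : q < F K
    q<F = <-≤-trans (m<m+n q (s≤s z≤n)) le

factor≡W : ∀ m n → factor m n ≡ W m n
factor≡W m n = trans (map-upTo (λ j → t (m + j)) n) (applyUpTo-W (λ j → t (m + j)) m n (λ _ → refl))
  where
  applyUpTo-W : ∀ (g : ℕ → Letter) m n → (∀ j → g j ≡ t (m + j)) → applyUpTo g n ≡ W m n
  applyUpTo-W g m zero    _ = refl
  applyUpTo-W g m (suc n) g≗ = cong₂ _∷_ (trans (g≗ 0) (cong t (+-identityʳ m)))
    (applyUpTo-W (λ j → g (suc j)) (suc m) n (λ j → trans (g≗ (suc j)) (cong t (+-suc m j))))

take-length-++ : ∀ {A : Set} (xs ys : List A) → take (length xs) (xs ++ ys) ≡ xs
take-length-++ []       ys = refl
take-length-++ (x ∷ xs) ys = cong (x ∷_) (take-length-++ xs ys)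

img : ℕ → ℕ → ℕ
img q m = length (φ* (W q m))

img-+ : ∀ q a b → img q (a + b) ≡ img q a + img (q + a) b
img-+ q a b = trans (cong (λ z → length (φ* z)) (W-++ q a b))
                    (trans (cong length (φ*-++ (W q a) (W (q + a) b))) (length-++ (φ* (W q a))))

-- A q = |φ(t[0,q))|.  Since t = φ(t), the prefix t[0,A q) is the image of t[0,q).
A : ℕ → ℕ
A q = img 0 q

φ-prefix : ∀ q → W 0 (A q) ≡ φ* (W 0 q)
φ-prefix q = begin
  W 0 (A q)                                        ≡⟨ W-φ^ (suc q) 0 (A q) A≤F ⟩
  take (A q) (φ^ suc q [0])                        ≡⟨ cong (take (A q)) split ⟩
  take (A q) (φ* (W 0 q) ++ φ* (drop q (φ^ q [0]))) ≡⟨ take-length-++ (φ* (W 0 q)) _ ⟩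
  φ* (W 0 q)                                       ∎
  where
  open ≡-Reasoning
  prefix-q : W 0 q ≡ take q (φ^ q [0])
  prefix-q = W-φ^ q 0 q (<⇒≤ (F-grow q))
  split : φ^ suc q [0] ≡ φ* (W 0 q) ++ φ* (drop q (φ^ q [0]))
  split = trans (cong φ* (sym (take++drop≡id q (φ^ q [0]))))
                (trans (φ*-++ (take q (φ^ q [0])) _) (cong (λ z → φ* z ++ φ* (drop q (φ^ q [0]))) (sym prefix-q)))
  A≤F : A q ≤ F (suc q)
  A≤F = subst (A q ≤_) (trans (sym (length-++ (φ* (W 0 q)))) (cong length (sym split))) (m≤m+n (A q) _)

A-+ : ∀ q m → A (q + m) ≡ A q + img q m
A-+ = img-+ 0

φ-image : ∀ q m → W (A q) (img q m) ≡ φ* (W q m)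
φ-image q m = ++-cancelˡ (φ* (W 0 q)) _ _ (begin
  φ* (W 0 q) ++ W (A q) (img q m)  ≡⟨ cong (_++ W (A q) (img q m)) (sym (φ-prefix q)) ⟩
  W 0 (A q) ++ W (A q) (img q m)   ≡⟨ sym (W-++ 0 (A q) (img q m)) ⟩
  W 0 (A q + img q m)              ≡⟨ cong (W 0) (sym (A-+ q m)) ⟩
  W 0 (A (q + m))                  ≡⟨ φ-prefix (q + m) ⟩
  φ* (W 0 (q + m))                 ≡⟨ cong φ* (W-++ 0 q m) ⟩
  φ* (W 0 q ++ W q m)              ≡⟨ φ*-++ (W 0 q) (W q m) ⟩
  φ* (W 0 q) ++ φ* (W q m)         ∎)
  where open ≡-Reasoning

-- Every φ-image starts with 0, so the letter at each position A q is 0.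
image-head : ∀ q → t (A q) ≡ zero
image-head q = starts-with-0 (t q) (φ-image q 1)
  where
  starts-with-0 : ∀ x → W (A q) (length (φ* (x ∷ []))) ≡ φ* (x ∷ []) → t (A q) ≡ zero
  starts-with-0 zero             e = just-injective (cong head e)
  starts-with-0 (suc zero)       e = just-injective (cong head e)
  starts-with-0 (suc (suc zero)) e = just-injective (cong head e)

-- Parikh vectors as integer vectors, so that they can be subtracted.
V : Set
V = ℤ × ℤ × ℤ

infixl 6 _⊕_ _⊖_

_⊕_ : V → V → V
(a , b , c) ⊕ (a′ , b′ , c′) = a ℤ.+ a′ , b ℤ.+ b′ , c ℤ.+ c′

_⊖_ : V → V → V
(a , b , c) ⊖ (a′ , b′ , c′) = a ℤ.- a′ , b ℤ.- b′ , c ℤ.- c′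

≡³ : ∀ {A B C : Set} {a a′ : A} {b b′ : B} {c c′ : C} → a ≡ a′ → b ≡ b′ → c ≡ c′ → (a , b , c) ≡ (a′ , b′ , c′)
≡³ p q r = cong₂ _,_ p (cong₂ _,_ q r)

e : Letter → V
e zero             = + 1 , + 0 , + 0
e (suc zero)       = + 0 , + 1 , + 0
e (suc (suc zero)) = + 0 , + 0 , + 1

ψ : List Letter → V
ψ w = + count zero w , + count (suc zero) w , + count (suc (suc zero)) w

-- The incidence matrix of φ: ψ(φ w) = M ψ(w), where M(a,b,c) = (a+b+c, a, b).
M : V → V
M (a , b , c) = a ℤ.+ b ℤ.+ c , a , b

ψ-∷ : ∀ x w → ψ (x ∷ w) ≡ e x ⊕ ψ w
ψ-∷ zero             w = refl
ψ-∷ (suc zero)       w = refl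
ψ-∷ (suc (suc zero)) w = refl

ψ-++ : ∀ u w → ψ (u ++ w) ≡ ψ u ⊕ ψ w
ψ-++ []      w = ≡³ (sym (ℤₚ.+-identityˡ _)) (sym (ℤₚ.+-identityˡ _)) (sym (ℤₚ.+-identityˡ _))
ψ-++ (x ∷ u) w = begin
  ψ (x ∷ u ++ w)      ≡⟨ ψ-∷ x (u ++ w) ⟩
  e x ⊕ ψ (u ++ w)    ≡⟨ cong (e x ⊕_) (ψ-++ u w) ⟩
  e x ⊕ (ψ u ⊕ ψ w)   ≡⟨ ⊕-assoc (e x) (ψ u) (ψ w) ⟩
  e x ⊕ ψ u ⊕ ψ w     ≡⟨ cong (_⊕ ψ w) (sym (ψ-∷ x u)) ⟩
  ψ (x ∷ u) ⊕ ψ w     ∎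
  where
  open ≡-Reasoning
  ⊕-assoc : ∀ u v w → u ⊕ (v ⊕ w) ≡ u ⊕ v ⊕ w
  ⊕-assoc (a , b , c) (a′ , b′ , c′) (a″ , b″ , c″) =
    ≡³ (sym (ℤₚ.+-assoc a a′ a″)) (sym (ℤₚ.+-assoc b b′ b″)) (sym (ℤₚ.+-assoc c c′ c″))

ψ-φ : ∀ w → ψ (φ* w) ≡ M (ψ w)
ψ-φ []      = refl
ψ-φ (x ∷ w) = begin
  ψ (φ x ++ φ* w)       ≡⟨ ψ-++ (φ x) (φ* w) ⟩
  ψ (φ x) ⊕ ψ (φ* w)    ≡⟨ cong₂ _⊕_ (image-of-letter x) (ψ-φ w) ⟩
  M (e x) ⊕ M (ψ w)     ≡⟨ M-additive (e x) (ψ w) ⟩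
  M (e x ⊕ ψ w)         ≡⟨ cong M (sym (ψ-∷ x w)) ⟩
  M (ψ (x ∷ w))         ∎
  where
  open ≡-Reasoning
  image-of-letter : ∀ x → ψ (φ x) ≡ M (e x)
  image-of-letter zero             = refl
  image-of-letter (suc zero)       = refl
  image-of-letter (suc (suc zero)) = refl
  M-additive : ∀ u v → M u ⊕ M v ≡ M (u ⊕ v)
  M-additive (a , b , c) (a′ , b′ , c′) = ≡³ (lemma a b c a′ b′ c′) refl refl
    where
    lemma : ∀ a b c a′ b′ c′ → a ℤ.+ b ℤ.+ c ℤ.+ (a′ ℤ.+ b′ ℤ.+ c′) ≡ a ℤ.+ a′ ℤ.+ (b ℤ.+ b′) ℤ.+ (c ℤ.+ c′)
    lemma = solve-∀

Ψrel-ψ : ∀ m n → Ψrel m n ≡ ψ (W m n) ⊖ ψ (W 0 n)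
Ψrel-ψ m n = cong₂ (λ u w → ψ u ⊖ ψ w) (factor≡W m n) (factor≡W 0 n)

D : ℕ → ℕ → V
D n k = ψ (W n k) ⊖ ψ (W 0 k)

-- Symmetry: the relative vector of the length-n factor at position m equals D n m,
-- since t[0,m+n) = t[0,m) t[m,m+n) = t[0,n) t[n,n+m).
Ψrel≡D : ∀ m n → Ψrel m n ≡ D n m
Ψrel≡D m n = trans (Ψrel-ψ m n) (rearrange (ψ (W 0 m)) (ψ (W m n)) (ψ (W 0 n)) (ψ (W n m)) two-ways)
  where
  two-ways : ψ (W 0 m) ⊕ ψ (W m n) ≡ ψ (W 0 n) ⊕ ψ (W n m)
  two-ways = begin
    ψ (W 0 m) ⊕ ψ (W m n)   ≡⟨ sym (ψ-++ (W 0 m) (W m n)) ⟩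
    ψ (W 0 m ++ W m n)      ≡⟨ cong ψ (sym (W-++ 0 m n)) ⟩
    ψ (W 0 (m + n))         ≡⟨ cong (λ z → ψ (W 0 z)) (+-comm m n) ⟩
    ψ (W 0 (n + m))         ≡⟨ cong ψ (W-++ 0 n m) ⟩
    ψ (W 0 n ++ W n m)      ≡⟨ ψ-++ (W 0 n) (W n m) ⟩
    ψ (W 0 n) ⊕ ψ (W n m)   ∎
    where open ≡-Reasoning
  rearrange : ∀ a x b y → a ⊕ x ≡ b ⊕ y → x ⊖ b ≡ y ⊖ a
  rearrange (a₁ , a₂ , a₃) (x₁ , x₂ , x₃) (b₁ , b₂ , b₃) (y₁ , y₂ , y₃) eq =
    ≡³ (coord a₁ x₁ b₁ y₁ (cong proj₁ eq)) (coord a₂ x₂ b₂ y₂ (cong (proj₁ ∘ proj₂) eq))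
       (coord a₃ x₃ b₃ y₃ (cong (proj₂ ∘ proj₂) eq))
    where
    coord : ∀ a x b y → a ℤ.+ x ≡ b ℤ.+ y → x ℤ.- b ≡ y ℤ.- a
    coord a x b y h = trans (lemma₁ a x b) (trans (cong (λ z → z ℤ.- b ℤ.- a) h) (lemma₂ b y a))
      where
      lemma₁ : ∀ a x b → x ℤ.- b ≡ a ℤ.+ x ℤ.- b ℤ.- a
      lemma₁ = solve-∀
      lemma₂ : ∀ b y a → b ℤ.+ y ℤ.- b ℤ.- a ≡ y ℤ.- a
      lemma₂ = solve-∀

-- Sum of the coordinates and the quantity |w|₀ + |w|₁ by which φ lengthens w.
total : V → ℤ
total (a , b , c) = a ℤ.+ b ℤ.+ c

gap : V → ℤ
gap (a , b , c) = a ℤ.+ b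

length-ψ : ∀ w → + length w ≡ total (ψ w)
length-ψ []      = refl
length-ψ (x ∷ w) = begin
  + 1 ℤ.+ + length w         ≡⟨ cong (λ z → + 1 ℤ.+ z) (length-ψ w) ⟩
  + 1 ℤ.+ total (ψ w)        ≡⟨ cong (ℤ._+ total (ψ w)) (sym (total-e x)) ⟩
  total (e x) ℤ.+ total (ψ w) ≡⟨ sym (total-⊕ (e x) (ψ w)) ⟩
  total (e x ⊕ ψ w)          ≡⟨ cong total (sym (ψ-∷ x w)) ⟩
  total (ψ (x ∷ w))          ∎
  where
  open ≡-Reasoning
  total-e : ∀ x → total (e x) ≡ + 1
  total-e zero             = refl
  total-e (suc zero)       = refl
  total-e (suc (suc zero)) = refl
  total-⊕ : ∀ u v → total (u ⊕ v) ≡ total u ℤ.+ total v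
  total-⊕ (a , b , c) (a′ , b′ , c′) = lemma a b c a′ b′ c′
    where
    lemma : ∀ a b c a′ b′ c′ → a ℤ.+ a′ ℤ.+ (b ℤ.+ b′) ℤ.+ (c ℤ.+ c′) ≡ a ℤ.+ b ℤ.+ c ℤ.+ (a′ ℤ.+ b′ ℤ.+ c′)
    lemma = solve-∀

length-φ : ∀ w → + length (φ* w) ≡ + length w ℤ.+ gap (ψ w)
length-φ w = begin
  + length (φ* w)            ≡⟨ length-ψ (φ* w) ⟩
  total (ψ (φ* w))           ≡⟨ cong total (ψ-φ w) ⟩
  total (M (ψ w))            ≡⟨ total-M (ψ w) ⟩
  total (ψ w) ℤ.+ gap (ψ w)  ≡⟨ cong (ℤ._+ gap (ψ w)) (sym (length-ψ w)) ⟩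
  + length w ℤ.+ gap (ψ w)   ∎
  where
  open ≡-Reasoning
  total-M : ∀ v → total (M v) ≡ total v ℤ.+ gap v
  total-M (a , b , c) = lemma a b c
    where
    lemma : ∀ a b c → a ℤ.+ b ℤ.+ c ℤ.+ a ℤ.+ b ≡ a ℤ.+ b ℤ.+ c ℤ.+ (a ℤ.+ b)
    lemma = solve-∀

img-difference : ∀ p j → + img p j ℤ.- + img 0 j ≡ gap (D p j)
img-difference p j = begin
  + img p j ℤ.- + img 0 j                                       ≡⟨ cong₂ ℤ._-_ (length-φ (W p j)) (length-φ (W 0 j)) ⟩
  + length (W p j) ℤ.+ gap u ℤ.- (+ length (W 0 j) ℤ.+ gap v)  ≡⟨ cong₂ (λ a b → + a ℤ.+ gap u ℤ.- (+ b ℤ.+ gap v)) (length-W p j) (length-W 0 j) ⟩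
  + j ℤ.+ gap u ℤ.- (+ j ℤ.+ gap v)                             ≡⟨ gap-⊖ (+ j) u v ⟩
  gap (u ⊖ v)                                                   ∎
  where
  open ≡-Reasoning
  u v : V
  u = ψ (W p j)
  v = ψ (W 0 j)
  gap-⊖ : ∀ n u v → n ℤ.+ gap u ℤ.- (n ℤ.+ gap v) ≡ gap (u ⊖ v)
  gap-⊖ n (a , b , c) (a′ , b′ , c′) = lemma n a b a′ b′
    where
    lemma : ∀ n a b a′ b′ → n ℤ.+ (a ℤ.+ b) ℤ.- (n ℤ.+ (a′ ℤ.+ b′)) ≡ a ℤ.- a′ ℤ.+ (b ℤ.- b′)
    lemma = solve-∀

diff-nonneg : ∀ a b g → + a ℤ.- + b ≡ + g → a ≡ b + g
diff-nonneg a b g eq = ℤₚ.+-injective (trans (split (+ a) (+ b)) (cong (λ z → + b ℤ.+ z) eq))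
  where
  split : ∀ a b → a ≡ b ℤ.+ (a ℤ.- b)
  split = solve-∀

diff-neg : ∀ a b g → + a ℤ.- + b ≡ -[1+ g ] → b ≡ a + suc g
diff-neg a b g eq = ℤₚ.+-injective (trans (split (+ a) (+ b)) (cong (λ z → + a ℤ.- z) eq))
  where
  split : ∀ a b → b ≡ a ℤ.- (a ℤ.- b)
  split = solve-∀

-- Offsets (x , y) that bring two lengths a, b with a - b = z to the common value max a b + o.
offsets : ℤ → ℕ → ℕ × ℕ
offsets (+ g)    o = o , o + g
offsets -[1+ g ] o = o + suc g , o

offsets-align : ∀ a b z o → + a ℤ.- + b ≡ z →
                a + proj₁ (offsets z o) ≡ a ⊔ b + o × b + proj₂ (offsets z o) ≡ a ⊔ b + o
offsets-align a b (+ g) o eq rewrite diff-nonneg a b g eq =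
  cong (_+ o) (sym b+g⊔b) , trans (lemma b o g) (cong (_+ o) (sym b+g⊔b))
  where
  b+g⊔b : b + g ⊔ b ≡ b + g
  b+g⊔b = m≥n⇒m⊔n≡m (m≤m+n b g)
  lemma : ∀ b o g → b + (o + g) ≡ b + g + o
  lemma = ℕ-Solver.solve-∀
offsets-align a b -[1+ g ] o eq rewrite diff-neg a b g eq =
  trans (lemma a o (suc g)) (cong (_+ o) (sym a⊔a+g)) , cong (_+ o) (sym a⊔a+g)
  where
  a⊔a+g : a ⊔ (a + suc g) ≡ a + suc g
  a⊔a+g = m≤n⇒m⊔n≡n (m≤m+n a (suc g))
  lemma : ∀ a o g → a + (o + g) ≡ a + g + o
  lemma = ℕ-Solver.solve-∀

offsets-mono : ∀ z {o} → o ≤ 1 → proj₁ (offsets z o) ≤ proj₁ (offsets z 1) × proj₂ (offsets z o) ≤ proj₂ (offsets z 1)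
offsets-mono (+ g)    {zero}     _ = z≤n , n≤1+n g
offsets-mono (+ g)    {suc zero} _ = ≤-refl , ≤-refl
offsets-mono -[1+ g ] {zero}     _ = n≤1+n (suc g) , z≤n
offsets-mono -[1+ g ] {suc zero} _ = ≤-refl , ≤-refl
offsets-mono z        {suc (suc o)} (s≤s ())

-- Each letter has an image of length 1 or 2, so img p grows by 1 or 2 per letter.
img-suc : ∀ p j → suc (img p j) ≤ img p (suc j) × img p (suc j) ≤ 2 + img p j
img-suc p j = lower , upper
  where
  open ≤-Reasoning
  letter-bounds : ∀ x → 1 ≤ length (φ* (x ∷ [])) × length (φ* (x ∷ [])) ≤ 2
  letter-bounds zero             = s≤s z≤n , s≤s (s≤s z≤n)
  letter-bounds (suc zero)       = s≤s z≤n , s≤s (s≤s z≤n)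
  letter-bounds (suc (suc zero)) = s≤s z≤n , s≤s z≤n
  ℓ : ℕ
  ℓ = img (p + j) 1
  img-+1 : img p (suc j) ≡ img p j + ℓ
  img-+1 = trans (cong (img p) (+-comm 1 j)) (img-+ p j 1)
  lower : suc (img p j) ≤ img p (suc j)
  lower = begin
    suc (img p j)  ≡⟨ +-comm 1 (img p j) ⟩
    img p j + 1    ≤⟨ +-monoʳ-≤ (img p j) (proj₁ (letter-bounds (t (p + j)))) ⟩
    img p j + ℓ    ≡⟨ sym img-+1 ⟩
    img p (suc j)  ∎
  upper : img p (suc j) ≤ 2 + img p j
  upper = begin
    img p (suc j)  ≡⟨ img-+1 ⟩
    img p j + ℓ    ≤⟨ +-monoʳ-≤ (img p j) (proj₂ (letter-bounds (t (p + j)))) ⟩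
    img p j + 2    ≡⟨ +-comm (img p j) 2 ⟩
    2 + img p j    ∎

img-≥ : ∀ p j → j ≤ img p j
img-≥ p zero    = z≤n
img-≥ p (suc j) = ≤-trans (s≤s (img-≥ p j)) (proj₁ (img-suc p j))

-- sync p j = max (img p j) (img 0 j): the first position from which the images of
-- t[p,p+j) and t[0,j) have both been passed.
sync : ℕ → ℕ → ℕ
sync p j = img p j ⊔ img 0 j

sync-≥ : ∀ p j → j ≤ sync p j
sync-≥ p j = ≤-trans (img-≥ p j) (m≤m⊔n (img p j) (img 0 j))

sync-≥-suc : ∀ p j → suc j ≤ sync p j + 1
sync-≥-suc p j = ≤-trans (s≤s (sync-≥ p j)) (≤-reflexive (+-comm 1 (sync p j)))

sync-suc : ∀ p j → sync p (suc j) ≡ suc (sync p j) ⊎ sync p (suc j) ≡ 2 + sync p j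
sync-suc p j with img-suc p j | img-suc 0 j
... | lowₚ , highₚ | low₀ , high₀ = one-or-two (⊔-mono-≤ lowₚ low₀) (⊔-mono-≤ highₚ high₀)
  where
  one-or-two : ∀ {c c′} → suc c ≤ c′ → c′ ≤ 2 + c → c′ ≡ suc c ⊎ c′ ≡ 2 + c
  one-or-two low high with m≤n⇒m<n∨m≡n high
  ... | inj₂ c′≡         = inj₂ c′≡
  ... | inj₁ (s≤s c′≤1+c) = inj₁ (≤-antisym c′≤1+c low)

sync-cover : ∀ p k → ∃[ j ] ∃[ o ] o ≤ 1 × k ≡ sync p j + o × (j < k ⊎ k ≡ 0)
sync-cover p zero = 0 , 0 , z≤n , refl , inj₂ refl
sync-cover p (suc k) with sync-cover p k
... | j , 0 , _ , refl , _ =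
  j , 1 , s≤s z≤n , sym (+-suc (sync p j) 0) , inj₁ (s≤s (≤-trans (sync-≥ p j) (m≤m+n _ 0)))
... | j , suc (suc o) , s≤s () , _ , _
... | j , 1 , _ , refl , _ with sync-suc p j
...   | inj₁ eq = suc j , 1 , s≤s z≤n , cong (_+ 1) (sym eq) , inj₁ (s≤s (sync-≥-suc p j))
...   | inj₂ eq = suc j , 0 , z≤n , trans (cong suc (+-comm (sync p j) 1)) (trans (sym eq) (sym (+-identityʳ _))) ,
                  inj₁ (s≤s (sync-≥-suc p j))

ahead : ℕ → ℕ → List Letter
ahead p j = φ* (W (p + j) 4)

ahead-in-t : ∀ p j → W (A p + img p j) (length (ahead p j)) ≡ ahead p j
ahead-in-t p j = subst (λ z → W z (length (ahead p j)) ≡ ahead p j) (A-+ p j) (φ-image (p + j) 4)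

ahead-prefix : ∀ p j {x} → x ≤ length (ahead p j) → W (A p + img p j) x ≡ take x (ahead p j)
ahead-prefix p j x≤ = trans (sym (take-W _ x≤)) (cong (take _) (ahead-in-t p j))

letter-in-image : ∀ p j {x} → x < length (ahead p j) → t (A p + img p j + x) ≡ nth zero (ahead p j) x
letter-in-image p j {x} x< = trans (sym (nth-W _ x<)) (cong (λ z → nth zero z x) (ahead-in-t p j))

window-in-image : ∀ p j x → x + 4 ≤ length (ahead p j) → W (A p + img p j + x) 4 ≡ take 4 (drop x (ahead p j))
window-in-image p j x x+4≤ = begin
  W (base + x) 4                           ≡⟨ sym (take-W (base + x) (m+n≤o⇒m≤o∸n 4 (subst (_≤ L) (+-comm x 4) x+4≤))) ⟩
  take 4 (W (base + x) (L ∸ x))            ≡⟨ cong (take 4) (sym (drop-W base (m+n≤o⇒m≤o x x+4≤))) ⟩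
  take 4 (drop x (W base L))               ≡⟨ cong (take 4 ∘ drop x) (ahead-in-t p j) ⟩
  take 4 (drop x (ahead p j))              ∎
  where
  open ≡-Reasoning
  base L : ℕ
  base = A p + img p j
  L = length (ahead p j)

ψ-image : ∀ p j {x} → x ≤ length (ahead p j) → ψ (W (A p) (img p j + x)) ≡ M (ψ (W p j)) ⊕ ψ (take x (ahead p j))
ψ-image p j {x} x≤ = begin
  ψ (W (A p) (img p j + x))                        ≡⟨ cong ψ (W-++ (A p) (img p j) x) ⟩
  ψ (W (A p) (img p j) ++ W (A p + img p j) x)     ≡⟨ ψ-++ (W (A p) (img p j)) _ ⟩
  ψ (W (A p) (img p j)) ⊕ ψ (W (A p + img p j) x)  ≡⟨ cong₂ _⊕_ (cong ψ (φ-image p j)) (cong ψ (ahead-prefix p j x≤)) ⟩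
  ψ (φ* (W p j)) ⊕ ψ (take x (ahead p j))          ≡⟨ cong (_⊕ ψ (take x (ahead p j))) (ψ-φ (W p j)) ⟩
  M (ψ (W p j)) ⊕ ψ (take x (ahead p j))           ∎
  where open ≡-Reasoning

D-image : ∀ p j {x y} → x ≤ length (ahead p j) → y ≤ length (ahead 0 j) → img p j + x ≡ img 0 j + y →
          D (A p) (img p j + x) ≡ M (D p j) ⊕ ψ (take x (ahead p j)) ⊖ ψ (take y (ahead 0 j))
D-image p j {x} {y} x≤ y≤ same = begin
  ψ (W (A p) (img p j + x)) ⊖ ψ (W 0 (img p j + x))
    ≡⟨ cong (λ k → ψ (W (A p) (img p j + x)) ⊖ ψ (W 0 k)) same ⟩
  ψ (W (A p) (img p j + x)) ⊖ ψ (W 0 (img 0 j + y))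
    ≡⟨ cong₂ _⊖_ (ψ-image p j x≤) (ψ-image 0 j y≤) ⟩
  (M (ψ (W p j)) ⊕ ψ (take x (ahead p j))) ⊖ (M (ψ (W 0 j)) ⊕ ψ (take y (ahead 0 j)))
    ≡⟨ M-difference (ψ (W p j)) (ψ (W 0 j)) _ _ ⟩
  M (D p j) ⊕ ψ (take x (ahead p j)) ⊖ ψ (take y (ahead 0 j))
    ∎
  where
  open ≡-Reasoning
  M-difference : ∀ u v a b → (M u ⊕ a) ⊖ (M v ⊕ b) ≡ M (u ⊖ v) ⊕ a ⊖ b
  M-difference (u₁ , u₂ , u₃) (v₁ , v₂ , v₃) (a₁ , a₂ , a₃) (b₁ , b₂ , b₃) =
    ≡³ (first u₁ u₂ u₃ v₁ v₂ v₃ a₁ b₁) (other u₁ v₁ a₂ b₂) (other u₂ v₂ a₃ b₃)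
    where
    first : ∀ u₁ u₂ u₃ v₁ v₂ v₃ a b →
            u₁ ℤ.+ u₂ ℤ.+ u₃ ℤ.+ a ℤ.- (v₁ ℤ.+ v₂ ℤ.+ v₃ ℤ.+ b) ≡ u₁ ℤ.- v₁ ℤ.+ (u₂ ℤ.- v₂) ℤ.+ (u₃ ℤ.- v₃) ℤ.+ a ℤ.- b
    first = solve-∀
    other : ∀ u v a b → u ℤ.+ a ℤ.- (v ℤ.+ b) ≡ u ℤ.- v ℤ.+ a ℤ.- b
    other = solve-∀

D-slide : ∀ q k → D (suc q) k ≡ D q k ⊕ e (t (q + k)) ⊖ e (t q)
D-slide q k = slide (e (t q)) (ψ (W (suc q) k)) (ψ (W q k)) (e (t (q + k))) (ψ (W 0 k)) two-ways
  where
  open ≡-Reasoning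
  ψ-[_] : ∀ x → ψ (x ∷ []) ≡ e x
  ψ-[ zero ]           = refl
  ψ-[ suc zero ]       = refl
  ψ-[ suc (suc zero) ] = refl
  two-ways : e (t q) ⊕ ψ (W (suc q) k) ≡ ψ (W q k) ⊕ e (t (q + k))
  two-ways = begin
    e (t q) ⊕ ψ (W (suc q) k)      ≡⟨ sym (ψ-∷ (t q) (W (suc q) k)) ⟩
    ψ (W q (suc k))                ≡⟨ cong (λ z → ψ (W q z)) (+-comm 1 k) ⟩
    ψ (W q (k + 1))                ≡⟨ cong ψ (W-++ q k 1) ⟩
    ψ (W q k ++ t (q + k) ∷ [])    ≡⟨ ψ-++ (W q k) _ ⟩
    ψ (W q k) ⊕ ψ (t (q + k) ∷ []) ≡⟨ cong (ψ (W q k) ⊕_) ψ-[ t (q + k) ] ⟩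
    ψ (W q k) ⊕ e (t (q + k))      ∎
  slide : ∀ a y x c w → a ⊕ y ≡ x ⊕ c → y ⊖ w ≡ x ⊖ w ⊕ c ⊖ a
  slide (a₁ , a₂ , a₃) (y₁ , y₂ , y₃) (x₁ , x₂ , x₃) (c₁ , c₂ , c₃) (w₁ , w₂ , w₃) eq =
    ≡³ (coord a₁ y₁ x₁ c₁ w₁ (cong proj₁ eq)) (coord a₂ y₂ x₂ c₂ w₂ (cong (proj₁ ∘ proj₂) eq))
       (coord a₃ y₃ x₃ c₃ w₃ (cong (proj₂ ∘ proj₂) eq))
    where
    coord : ∀ a y x c w → a ℤ.+ y ≡ x ℤ.+ c → y ℤ.- w ≡ x ℤ.- w ℤ.+ c ℤ.- a
    coord a y x c w h = trans (lemma₁ a y w) (trans (cong (λ z → z ℤ.- a ℤ.- w) h) (lemma₂ x c a w))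
      where
      lemma₁ : ∀ a y w → y ℤ.- w ≡ a ℤ.+ y ℤ.- a ℤ.- w
      lemma₁ = solve-∀
      lemma₂ : ∀ x c a w → x ℤ.+ c ℤ.- a ℤ.- w ≡ x ℤ.- w ℤ.+ c ℤ.- a
      lemma₂ = solve-∀

-- The configuration at shift n and position k: the vector D n k together with the
-- next four letters t[n+k,n+k+4) of the factor and t[k,k+4) of the prefix.
Config : Set
Config = V × List Letter × List Letter

config : ℕ → ℕ → Config
config n k = D n k , W (n + k) 4 , W k 4

bit : Bool → ℕ
bit false = 0
bit true  = 1

-- The configuration after the image: for images X, Y of the look-ahead words and
-- offsets x, y into them; for d = true the shift is one more, which (the image starting
-- with 0) trades a letter 0 for the letter X[x].
nextAt : Bool → V → List Letter → List Letter → ℕ → ℕ → Config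
nextAt false δ X Y x y = M δ ⊕ ψ (take x X) ⊖ ψ (take y Y) , take 4 (drop x X) , take 4 (drop y Y)
nextAt true  δ X Y x y = M δ ⊕ ψ (take x X) ⊖ ψ (take y Y) ⊕ e (nth zero X x) ⊖ e zero ,
                         take 4 (drop (suc x) X) , take 4 (drop y Y)

-- The transition: configuration (δ , u , v) at shift p, position j, yields the
-- configuration at shift bit d + A p and position sync p j + o.
next : Bool → Config → ℕ → Config
next d (δ , u , v) o = nextAt d δ (φ* u) (φ* v) (proj₁ (offsets (gap δ) o)) (proj₂ (offsets (gap δ) o))

-- The look-ahead words are long enough for both offsets o = 0, 1.
Good : Config → Set
Good (δ , u , v) = suc (proj₁ (offsets (gap δ) 1)) + 4 ≤ length (φ* u) × proj₂ (offsets (gap δ) 1) + 4 ≤ length (φ* v)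

config-image : ∀ d p j {x y} → img p j + x ≡ img 0 j + y → suc x + 4 ≤ length (ahead p j) → y + 4 ≤ length (ahead 0 j) →
               config (bit d + A p) (img p j + x) ≡ nextAt d (D p j) (ahead p j) (ahead 0 j) x y
config-image false p j {x} {y} same x+5≤ y+4≤ =
  ≡³ (D-image p j (≤-trans (m≤m+n x 4) x+4≤) (m+n≤o⇒m≤o y y+4≤) same)
     (trans (cong (λ z → W z 4) (sym (+-assoc (A p) (img p j) x))) (window-in-image p j x x+4≤))
     (trans (cong (λ z → W z 4) same) (window-in-image 0 j y y+4≤))
  where
  x+4≤ : x + 4 ≤ length (ahead p j)
  x+4≤ = ≤-trans (n≤1+n _) x+5≤
config-image true p j {x} {y} same x+5≤ y+4≤ =
  ≡³ D-part
     (trans (cong (λ z → W z 4) (reassoc (A p) (img p j) x)) (window-in-image p j (suc x) x+5≤))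
     (trans (cong (λ z → W z 4) same) (window-in-image 0 j y y+4≤))
  where
  open ≡-Reasoning
  k : ℕ
  k = img p j + x
  x+4≤ : x + 4 ≤ length (ahead p j)
  x+4≤ = ≤-trans (n≤1+n _) x+5≤
  reassoc : ∀ a b c → suc (a + (b + c)) ≡ a + b + suc c
  reassoc = ℕ-Solver.solve-∀
  D-part : D (suc (A p)) k ≡ M (D p j) ⊕ ψ (take x (ahead p j)) ⊖ ψ (take y (ahead 0 j)) ⊕ e (nth zero (ahead p j) x) ⊖ e zero
  D-part = begin
    D (suc (A p)) k
      ≡⟨ D-slide (A p) k ⟩
    D (A p) k ⊕ e (t (A p + k)) ⊖ e (t (A p))
      ≡⟨ cong (λ a → D (A p) k ⊕ e (t (A p + k)) ⊖ e a) (image-head p) ⟩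
    D (A p) k ⊕ e (t (A p + k)) ⊖ e zero
      ≡⟨ cong₂ (λ δ a → δ ⊕ e a ⊖ e zero) (D-image p j (≤-trans (m≤m+n x 4) x+4≤) (m+n≤o⇒m≤o y y+4≤) same) next-letter ⟩
    M (D p j) ⊕ ψ (take x (ahead p j)) ⊖ ψ (take y (ahead 0 j)) ⊕ e (nth zero (ahead p j) x) ⊖ e zero
      ∎
    where
    next-letter : t (A p + k) ≡ nth zero (ahead p j) x
    next-letter = trans (cong t (sym (+-assoc (A p) (img p j) x))) (letter-in-image p j (≤-trans (s≤s (m≤m+n x 4)) x+5≤))

config-step : ∀ d p k → ∃[ j ] ∃[ o ] o ≤ 1 × (j < k ⊎ k ≡ 0) ×
              (Good (config p j) → config (bit d + A p) k ≡ next d (config p j) o)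
config-step d p k with sync-cover p k
... | j , o , o≤1 , refl , j<k = j , o , o≤1 , j<k , from-good
  where
  z : ℤ
  z = gap (D p j)
  aligned : img p j + proj₁ (offsets z o) ≡ sync p j + o × img 0 j + proj₂ (offsets z o) ≡ sync p j + o
  aligned = offsets-align (img p j) (img 0 j) z o (img-difference p j)
  from-good : Good (config p j) → config (bit d + A p) (sync p j + o) ≡ next d (config p j) o
  from-good (x₁+5≤ , y₁+4≤) =
    trans (cong (config (bit d + A p)) (sym (proj₁ aligned)))
          (config-image d p j (trans (proj₁ aligned) (sym (proj₂ aligned))) x+5≤ y+4≤)
    where
    x+5≤ : suc (proj₁ (offsets z o)) + 4 ≤ length (ahead p j)
    x+5≤ = ≤-trans (+-monoˡ-≤ 4 (s≤s (proj₁ (offsets-mono z o≤1)))) x₁+5≤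
    y+4≤ : proj₂ (offsets z o) + 4 ≤ length (ahead 0 j)
    y+4≤ = ≤-trans (+-monoˡ-≤ 4 (proj₂ (offsets-mono z o≤1))) y₁+4≤

_≟ᵥ_ : DecidableEquality V
_≟ᵥ_ = ×-≡-dec ℤₚ._≟_ (×-≡-dec ℤₚ._≟_ ℤₚ._≟_)

_≟ᶜ_ : DecidableEquality Config
_≟ᶜ_ = ×-≡-dec _≟ᵥ_ (×-≡-dec (List-≡-dec Finₚ._≟_) (List-≡-dec Finₚ._≟_))

open import Data.List.Relation.Binary.Subset.DecPropositional _≟ᶜ_ using (_⊆_; _⊆?_)
open import Data.List.Membership.DecPropositional _≟ᶜ_ using () renaming (_∈?_ to _∈ᶜ?_)
open import Data.List.Membership.DecPropositional _≟ᵥ_ using () renaming (_∈?_ to _∈ᵥ?_)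
open import Data.List.Relation.Unary.Unique.DecPropositional _≟ᵥ_ using (unique?)

good? : ∀ s → Dec (Good s)
good? (δ , u , v) = (_ ≤? _) ×-dec (_ ≤? _)

successors : Bool → List Config → List Config
successors d []      = []
successors d (s ∷ L) = next d s 0 ∷ next d s 1 ∷ successors d L

step : Bool → List Config → List Config
step d L = deduplicate _≟ᶜ_ (successors d L)

∈-step : ∀ d {s L o} → s ∈ L → o ≤ 1 → next d s o ∈ step d L
∈-step d s∈L o≤1 = ∈-deduplicate⁺ _≟ᶜ_ (∈-successors s∈L o≤1)
  where
  ∈-successors : ∀ {s L o} → s ∈ L → o ≤ 1 → next d s o ∈ successors d L
  ∈-successors {o = zero}        (here refl) _          = here refl
  ∈-successors {o = suc zero}    (here refl) _          = there (here refl)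
  ∈-successors {o = suc (suc o)} (here refl) (s≤s ())
  ∈-successors (there s∈L) o≤1 = there (there (∈-successors s∈L o≤1))

Inv : ℕ → List Config → Set
Inv n L = ∀ k → config n k ∈ L

step-invariant : ∀ d {p L} → Inv p L → All Good L → Inv (bit d + A p) (step d L)
step-invariant d {p} {L} inv good k with config-step d p k
... | j , o , o≤1 , _ , from-good =
  subst (_∈ step d L) (sym (from-good (All.lookup good (inv j)))) (∈-step d (inv j) o≤1)

-- For d = false the shift 0 is mapped to itself; by strong induction on the position
-- a list containing config 0 0 and closed under the step contains all of them.
invariant-0 : ∀ {L} → config 0 0 ∈ L → All Good L → step false L ⊆ L → Inv 0 L
invariant-0 {L} start∈L good closed = <-rec (λ k → config 0 k ∈ L) earlier
  where
  earlier : ∀ k → (∀ {j} → j < k → config 0 j ∈ L) → config 0 k ∈ L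
  earlier k ih with config-step false 0 k
  ... | j , o , o≤1 , inj₂ refl , _         = start∈L
  ... | j , o , o≤1 , inj₁ j<k , from-good =
    closed (subst (_∈ step false L) (sym (from-good (All.lookup good (ih j<k)))) (∈-step false (ih j<k) o≤1))

shiftBy : List Bool → ℕ → ℕ
shiftBy []       p = p
shiftBy (d ∷ ds) p = shiftBy ds (bit d + A p)

run : List Bool → List Config → List Config
run []       L = L
run (d ∷ ds) L = run ds (step d L)

Safe : List Bool → List Config → Set
Safe []       L = ⊤
Safe (d ∷ ds) L = All Good L × Safe ds (step d L)

safe? : ∀ ds L → Dec (Safe ds L)
safe? []       L = yes tt
safe? (d ∷ ds) L = all? good? L ×-dec safe? ds (step d L)

run-invariant : ∀ ds {p L} → Inv p L → Safe ds L → Inv (shiftBy ds p) (run ds L)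
run-invariant []       inv _              = inv
run-invariant (d ∷ ds) inv (good , safe) = run-invariant ds (step-invariant d inv good) safe

-- N′ i = N_i via the recursion N_{i+1} = 1 + A (A (A (A N_i))), one run of `period`.
period : List Bool
period = false ∷ false ∷ false ∷ true ∷ []

N′ : ℕ → ℕ
N′ zero    = 1
N′ (suc i) = shiftBy period (N′ i)

φ⁴ : List Letter → List Letter
φ⁴ w = φ* (φ* (φ* (φ* w)))

φ⁴-++ : ∀ u w → φ⁴ (u ++ w) ≡ φ⁴ u ++ φ⁴ w
φ⁴-++ u w = begin
  φ* (φ* (φ* (φ* (u ++ w))))                     ≡⟨ cong (φ* ∘ φ* ∘ φ*) (φ*-++ u w) ⟩
  φ* (φ* (φ* (φ* u ++ φ* w)))                    ≡⟨ cong (φ* ∘ φ*) (φ*-++ (φ* u) (φ* w)) ⟩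
  φ* (φ* (φ* (φ* u) ++ φ* (φ* w)))               ≡⟨ cong φ* (φ*-++ (φ* (φ* u)) (φ* (φ* w))) ⟩
  φ* (φ* (φ* (φ* u)) ++ φ* (φ* (φ* w)))          ≡⟨ φ*-++ (φ* (φ* (φ* u))) (φ* (φ* (φ* w))) ⟩
  φ⁴ u ++ φ⁴ w                                   ∎
  where open ≡-Reasoning

φ⁴-prefix : ∀ p → W 0 (A (A (A (A p)))) ≡ φ⁴ (W 0 p)
φ⁴-prefix p =
  trans (φ-prefix (A (A (A p))))
        (cong φ* (trans (φ-prefix (A (A p))) (cong φ* (trans (φ-prefix (A p)) (cong φ* (φ-prefix p))))))

prefix-N′-suc : ∀ i → W 0 (N′ (suc i)) ≡ φ⁴ (W 0 (N′ i)) ++ zero ∷ []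
prefix-N′-suc i = begin
  W 0 (suc a₄)             ≡⟨ cong (W 0) (+-comm 1 a₄) ⟩
  W 0 (a₄ + 1)             ≡⟨ W-++ 0 a₄ 1 ⟩
  W 0 a₄ ++ t a₄ ∷ []      ≡⟨ cong₂ (λ u x → u ++ x ∷ []) (φ⁴-prefix (N′ i)) (image-head (A (A (A (N′ i))))) ⟩
  φ⁴ (W 0 (N′ i)) ++ zero ∷ [] ∎
  where
  open ≡-Reasoning
  a₄ : ℕ
  a₄ = A (A (A (A (N′ i))))

prefix-N′-split : ∀ i → W 0 (N′ (suc i)) ≡ φ^ (4 * suc i) [0] ++ W 0 (N′ i)
prefix-N′-split zero    = prefix-N′-suc 0
prefix-N′-split (suc i) = begin
  W 0 (N′ (2 + i))                                             ≡⟨ prefix-N′-suc (suc i) ⟩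
  φ⁴ (W 0 (N′ (suc i))) ++ [0]                                 ≡⟨ cong (λ z → φ⁴ z ++ [0]) (prefix-N′-split i) ⟩
  φ⁴ (φ^ (4 * suc i) [0] ++ W 0 (N′ i)) ++ [0]                 ≡⟨ cong (_++ [0]) (φ⁴-++ (φ^ (4 * suc i) [0]) _) ⟩
  (φ⁴ (φ^ (4 * suc i) [0]) ++ φ⁴ (W 0 (N′ i))) ++ [0]          ≡⟨ ++-assoc (φ⁴ (φ^ (4 * suc i) [0])) _ [0] ⟩
  φ⁴ (φ^ (4 * suc i) [0]) ++ (φ⁴ (W 0 (N′ i)) ++ [0])          ≡⟨ cong₂ _++_ (cong φ^_[0] (sym (*-suc 4 (suc i)))) (sym (prefix-N′-suc i)) ⟩
  φ^ (4 * suc (suc i)) [0] ++ W 0 (N′ (suc i))                 ∎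
  where
  open ≡-Reasoning
  [0] : List Letter
  [0] = zero ∷ []

-- Taking lengths gives N′ (i+1) = N′ i + F_{4(i+1)}, the recursion defining N.
N′≡N : ∀ i → N′ i ≡ N i
N′≡N zero    = refl
N′≡N (suc i) = begin
  N′ (suc i)                                 ≡⟨ sym (length-W 0 (N′ (suc i))) ⟩
  length (W 0 (N′ (suc i)))                  ≡⟨ cong length (prefix-N′-split i) ⟩
  length (φ^ (4 * suc i) [0] ++ W 0 (N′ i))  ≡⟨ length-++ (φ^ (4 * suc i) [0]) ⟩
  F (4 * suc i) + length (W 0 (N′ i))        ≡⟨ cong (_+_ (F (4 * suc i))) (trans (length-W 0 (N′ i)) (N′≡N i)) ⟩
  F (4 * suc i) + N i                        ≡⟨ +-comm (F (4 * suc i)) (N i) ⟩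
  N i + F (4 * suc i)                        ∎
  where open ≡-Reasoning

v₀ v₁ v₂ v₃ v₄ : V
v₀ = + 0 , + 0 , + 0
v₁ = -[1+ 0 ] , + 1 , + 0
v₂ = -[1+ 0 ] , + 0 , + 1
v₃ = + 0 , -[1+ 0 ] , + 1
v₄ = + 0 , + 1 , -[1+ 0 ]

S₅ : List V
S₅ = v₀ ∷ v₁ ∷ v₂ ∷ v₃ ∷ v₄ ∷ []

saturate : ℕ → (List Config → List Config) → List Config → List Config
saturate zero    f L = L
saturate (suc n) f L = saturate n f (deduplicate _≟ᶜ_ (L ++ f L))

-- The nine configurations at shift 0 (where D 0 k = 0), found from config 0 0.
L₀ : List Config
L₀ = saturate 8 (step false) (config 0 0 ∷ [])

L₁ : List Config
L₁ = step true L₀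

-- A length-4 word written as a four-digit numeral, e.g. word 1020 = 1 0 2 0.
word : ℕ → List Letter
word n = digit (n / 1000) ∷ digit (n / 100 % 10) ∷ digit (n / 10 % 10) ∷ digit (n % 10) ∷ []
  where
  digit : ℕ → Letter
  digit 0 = zero
  digit 1 = suc zero
  digit _ = suc (suc zero)

⟨_∣_∣_⟩ : V → ℕ → ℕ → Config
⟨ δ ∣ u ∣ v ⟩ = δ , word u , word v

-- The configurations at the shifts N′ i, i ≥ 2: a list closed under one period
-- (obtained by saturating the configurations at shift N′ 2 under `period`).
U : List Config
U =
  ⟨ v₀ ∣ 0101 ∣ 0100 ⟩ ∷ ⟨ v₀ ∣ 0102 ∣ 0010 ⟩ ∷ ⟨ v₀ ∣ 0102 ∣ 0100 ⟩ ∷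
  ⟨ v₀ ∣ 0102 ∣ 0102 ⟩ ∷ ⟨ v₀ ∣ 0102 ∣ 0201 ⟩ ∷ ⟨ v₀ ∣ 0201 ∣ 0010 ⟩ ∷
  ⟨ v₀ ∣ 0201 ∣ 0201 ⟩ ∷ ⟨ v₀ ∣ 1001 ∣ 0100 ⟩ ∷ ⟨ v₀ ∣ 1001 ∣ 0101 ⟩ ∷
  ⟨ v₀ ∣ 1001 ∣ 0102 ⟩ ∷ ⟨ v₀ ∣ 1010 ∣ 0101 ⟩ ∷ ⟨ v₀ ∣ 1010 ∣ 1001 ⟩ ∷
  ⟨ v₀ ∣ 1020 ∣ 0100 ⟩ ∷ ⟨ v₀ ∣ 1020 ∣ 0101 ⟩ ∷ ⟨ v₀ ∣ 1020 ∣ 0102 ⟩ ∷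
  ⟨ v₀ ∣ 1020 ∣ 1001 ⟩ ∷ ⟨ v₀ ∣ 1020 ∣ 1020 ⟩ ∷ ⟨ v₀ ∣ 1020 ∣ 2010 ⟩ ∷
  ⟨ v₀ ∣ 2010 ∣ 0010 ⟩ ∷ ⟨ v₀ ∣ 2010 ∣ 0102 ⟩ ∷ ⟨ v₀ ∣ 2010 ∣ 0201 ⟩ ∷
  ⟨ v₀ ∣ 2010 ∣ 2010 ⟩ ∷ ⟨ v₁ ∣ 0010 ∣ 1001 ⟩ ∷ ⟨ v₁ ∣ 0010 ∣ 1010 ⟩ ∷
  ⟨ v₁ ∣ 0010 ∣ 1020 ⟩ ∷ ⟨ v₁ ∣ 0102 ∣ 1010 ⟩ ∷ ⟨ v₁ ∣ 0201 ∣ 1001 ⟩ ∷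
  ⟨ v₁ ∣ 0201 ∣ 1010 ⟩ ∷ ⟨ v₁ ∣ 0201 ∣ 1020 ⟩ ∷ ⟨ v₂ ∣ 0010 ∣ 0201 ⟩ ∷
  ⟨ v₂ ∣ 0010 ∣ 2010 ⟩ ∷ ⟨ v₂ ∣ 0100 ∣ 0102 ⟩ ∷ ⟨ v₂ ∣ 0100 ∣ 1020 ⟩ ∷
  ⟨ v₂ ∣ 0100 ∣ 2010 ⟩ ∷ ⟨ v₂ ∣ 0101 ∣ 1020 ⟩ ∷ ⟨ v₂ ∣ 0101 ∣ 2010 ⟩ ∷
  ⟨ v₂ ∣ 0102 ∣ 2010 ⟩ ∷ ⟨ v₂ ∣ 1001 ∣ 1020 ⟩ ∷ ⟨ v₃ ∣ 1001 ∣ 0201 ⟩ ∷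
  ⟨ v₃ ∣ 1010 ∣ 0201 ⟩ ∷ ⟨ v₄ ∣ 0201 ∣ 0100 ⟩ ∷ ⟨ v₄ ∣ 2010 ∣ 1001 ⟩ ∷ []

L₀-start : config 0 0 ∈ L₀
L₀-start = toWitness {a? = config 0 0 ∈ᶜ? L₀} tt

L₀-good : All Good L₀
L₀-good = toWitness {a? = all? good? L₀} tt

L₀-closed : step false L₀ ⊆ L₀
L₀-closed = toWitness {a? = step false L₀ ⊆? L₀} tt

L₁-safe : Safe (period ++ period) L₁
L₁-safe = toWitness {a? = safe? (period ++ period) L₁} tt

L₁-run⊆U : run (period ++ period) L₁ ⊆ U
L₁-run⊆U = toWitness {a? = run (period ++ period) L₁ ⊆? U} tt

U-safe : Safe period U
U-safe = toWitness {a? = safe? period U} tt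

U-closed : run period U ⊆ U
U-closed = toWitness {a? = run period U ⊆? U} tt

U-vectors : All (λ s → proj₁ s ∈ S₅) U
U-vectors = toWitness {a? = all? (λ s → proj₁ s ∈ᵥ? S₅) U} tt

invariant-N′₀ : Inv (N′ 0) L₁
invariant-N′₀ = step-invariant true (invariant-0 L₀-start L₀-good L₀-closed) L₀-good

invariant-N′ : ∀ i → Inv (N′ (2 + i)) U
invariant-N′ zero    k = L₁-run⊆U (run-invariant (period ++ period) invariant-N′₀ L₁-safe k)
invariant-N′ (suc i) k = U-closed (run-invariant period (invariant-N′ i) U-safe k)

window-of-image : ∀ r q L → r + L ≤ img q L → W (r + A q) L ≡ take L (drop r (φ* (W q L)))
window-of-image r q L r+L≤ = begin
  W (r + A q) L                          ≡⟨ cong (λ z → W z L) (+-comm r (A q)) ⟩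
  W (A q + r) L                          ≡⟨ sym (take-W (A q + r) (m+n≤o⇒m≤o∸n L (subst (_≤ img q L) (+-comm r L) r+L≤))) ⟩
  take L (W (A q + r) (img q L ∸ r))     ≡⟨ cong (take L) (sym (drop-W (A q) (m+n≤o⇒m≤o r r+L≤))) ⟩
  take L (drop r (W (A q) (img q L)))    ≡⟨ cong (take L ∘ drop r) (φ-image q L) ⟩
  take L (drop r (φ* (W q L)))           ∎
  where open ≡-Reasoning

-- Windows of length 177 (reaching the largest witness position) followed along a schedule.
windowStep : Bool → List Letter → List Letter
windowStep d c = take 177 (drop (bit d) (φ* c))

runWindow : List Bool → List Letter → List Letter
runWindow []       c = c
runWindow (d ∷ ds) c = runWindow ds (windowStep d c)

Fits : List Bool → List Letter → Set
Fits []       c = ⊤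
Fits (d ∷ ds) c = bit d + 177 ≤ length (φ* c) × Fits ds (windowStep d c)

fits? : ∀ ds c → Dec (Fits ds c)
fits? []       c = yes tt
fits? (d ∷ ds) c = (_ ≤? _) ×-dec fits? ds (windowStep d c)

run-window : ∀ ds q {c} → W q 177 ≡ c → Fits ds c → W (shiftBy ds q) 177 ≡ runWindow ds c
run-window []       q eq   _             = eq
run-window (d ∷ ds) q refl (fits , rest) = run-window ds (bit d + A q) (window-of-image (bit d) q 177 fits) rest

Q : ℕ → List Letter
Q zero    = take 177 (drop 1 (φ^ 9 [0]))
Q (suc i) = runWindow period (Q i)

Q-stable : ∀ i → Q (2 + i) ≡ Q 2
Q-stable zero    = refl
Q-stable (suc i) = trans (cong (runWindow period) (Q-stable i)) Q₂-fixed
  where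
  Q₂-fixed : runWindow period (Q 2) ≡ Q 2
  Q₂-fixed = refl

Q-fits : ∀ i → Fits period (Q i)
Q-fits zero          = toWitness {a? = fits? period (Q 0)} tt
Q-fits (suc zero)    = toWitness {a? = fits? period (Q 1)} tt
Q-fits (suc (suc i)) = subst (Fits period) (sym (Q-stable i)) (toWitness {a? = fits? period (Q 2)} tt)

window-N′ : ∀ i → W (N′ i) 177 ≡ Q i
window-N′ zero    = W-φ^ 9 1 177 (toWitness {a? = 178 ≤? F 9} tt)
window-N′ (suc i) = run-window period (N′ i) (window-N′ i) (Q-fits i)

T : List Letter
T = take 177 (φ^ 9 [0])

prefix-177 : W 0 177 ≡ T
prefix-177 = W-φ^ 9 0 177 (toWitness {a? = 177 ≤? F 9} tt)

D-N′ : ∀ i {m} → m ≤ 177 → D (N′ (2 + i)) m ≡ ψ (take m (Q 2)) ⊖ ψ (take m T)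
D-N′ i {m} m≤ = cong₂ (λ u w → ψ u ⊖ ψ w)
  (trans (sym (take-W _ m≤)) (cong (take m) (trans (window-N′ (2 + i)) (Q-stable i))))
  (trans (sym (take-W 0 m≤)) (cong (take m) prefix-177))

relAt : ℕ → List ℕ → List V
relAt n ms = map (λ m → Ψrel m n) ms

Prel-exact : ∀ n ms → (∀ m → Ψrel m n ∈ relAt n ms) → ∀ v → v ∈Prel n ⇔ v ∈ relAt n ms
Prel-exact n ms complete v = mk⇔ (λ { (m , refl) → complete m }) realised
  where
  realised : v ∈ relAt n ms → v ∈Prel n
  realised v∈ with ∈-map⁻ (λ m → Ψrel m n) v∈
  ... | m , _ , v≡ = m , sym v≡

Ψ-from-rel : ∀ m m′ n → Ψrel m n ≡ Ψrel m′ n → Ψ (factor m n) ≡ Ψ (factor m′ n)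
Ψ-from-rel m m′ n eq = ψ-injective {factor m n} {factor m′ n} (⊖-cancelʳ (ψ (factor m n)) (ψ (factor m′ n)) (ψ (prefix n)) eq)
  where
  ⊖-cancelʳ : ∀ x y z → x ⊖ z ≡ y ⊖ z → x ≡ y
  ⊖-cancelʳ (x₁ , x₂ , x₃) (y₁ , y₂ , y₃) (z₁ , z₂ , z₃) eq =
    ≡³ (cancel x₁ y₁ z₁ (cong proj₁ eq)) (cancel x₂ y₂ z₂ (cong (proj₁ ∘ proj₂) eq)) (cancel x₃ y₃ z₃ (cong (proj₂ ∘ proj₂) eq))
    where
    cancel : ∀ a b c → a ℤ.- c ≡ b ℤ.- c → a ≡ b
    cancel a b c h = trans (undo a c) (trans (cong (ℤ._+ c) h) (sym (undo b c)))
      where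
      undo : ∀ x c → x ≡ x ℤ.- c ℤ.+ c
      undo = solve-∀
  ψ-injective : ∀ {u u′} → ψ u ≡ ψ u′ → Ψ u ≡ Ψ u′
  ψ-injective e = ≡³ (ℤₚ.+-injective (cong proj₁ e)) (ℤₚ.+-injective (cong (proj₁ ∘ proj₂) e))
                     (ℤₚ.+-injective (cong (proj₂ ∘ proj₂) e))

AC-exact : ∀ n ms → (∀ m → Ψrel m n ∈ relAt n ms) → Unique (relAt n ms) → AC n ≡ length ms
AC-exact n ms complete distinct = map Ψ-at ms , length-map Ψ-at ms , Uniqueₚ.map⁻ distinct′ , λ v → mk⇔ (listed v) (realised v)
  where
  Ψ-at : ℕ → ℕ × ℕ × ℕ
  Ψ-at m = Ψ (factor m n)
  relative : ℕ × ℕ × ℕ → V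
  relative (a , b , c) = (+ a , + b , + c) ⊖ ψ (prefix n)
  distinct′ : Unique (map relative (map Ψ-at ms))
  distinct′ = subst Unique (map-∘ ms) distinct
  listed : ∀ v → v ∈ map Ψ-at ms → ∃[ m ] Ψ (factor m n) ≡ v
  listed v v∈ with ∈-map⁻ Ψ-at v∈
  ... | m , _ , v≡ = m , sym v≡
  realised : ∀ v → (∃[ m ] Ψ (factor m n) ≡ v) → v ∈ map Ψ-at ms
  realised v (m , refl) with ∈-map⁻ (λ m → Ψrel m n) (complete m)
  ... | m′ , m′∈ , same = subst (_∈ map Ψ-at ms) (sym (Ψ-from-rel m m′ n same)) (∈-map⁺ Ψ-at m′∈)

witnesses : List ℕ
witnesses = 0 ∷ 1 ∷ 3 ∷ 15 ∷ 177 ∷ []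

N-as-N′ : ∀ i → 2 ≤ i → N i ≡ N′ (2 + (i ∸ 2))
N-as-N′ i 2≤i = trans (cong N (sym (m+[n∸m]≡n 2≤i))) (sym (N′≡N (2 + (i ∸ 2))))

Ψrel-N : ∀ i → 2 ≤ i → ∀ m → Ψrel m (N i) ≡ D (N′ (2 + (i ∸ 2))) m
Ψrel-N i 2≤i m = trans (Ψrel≡D m (N i)) (cong (λ n → D n m) (N-as-N′ i 2≤i))

upper-bound : ∀ i → 2 ≤ i → ∀ m → Ψrel m (N i) ∈ S₅
upper-bound i 2≤i m = subst (_∈ S₅) (sym (Ψrel-N i 2≤i m)) (All.lookup U-vectors (invariant-N′ (i ∸ 2) m))

realised-N : ∀ i → 2 ≤ i → relAt (N i) witnesses ≡ S₅
realised-N i 2≤i = trans (map-cong-local {f = λ m → Ψrel m (N i)} {g = window-vector} pointwise) computed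
  where
  window-vector : ℕ → V
  window-vector m = ψ (take m (Q 2)) ⊖ ψ (take m T)
  bounded : All (_≤ 177) witnesses
  bounded = toWitness {a? = all? (_≤? 177) witnesses} tt
  pointwise : All (λ m → Ψrel m (N i) ≡ window-vector m) witnesses
  pointwise = All.map (λ {m} m≤ → trans (Ψrel-N i 2≤i m) (D-N′ (i ∸ 2) m≤)) bounded
  computed : map window-vector witnesses ≡ S₅
  computed = refl

complete-N : ∀ i → 2 ≤ i → ∀ m → Ψrel m (N i) ∈ relAt (N i) witnesses
complete-N i 2≤i m = subst (Ψrel m (N i) ∈_) (sym (realised-N i 2≤i)) (upper-bound i 2≤i m)

S₅-distinct : Unique S₅
S₅-distinct = toWitness {a? = unique? S₅} tt

N-≥ : ∀ i → i ≤ N i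
N-≥ zero    = z≤n
N-≥ (suc i) = subst (_≤ N i + F (4 * suc i)) (+-comm i 1) (+-mono-≤ (N-≥ i) (≤-trans (s≤s z≤n) (F-grow (4 * suc i))))

corollary7p4 :
    (∀ (i : ℕ) → 2 ≤ i → ∀ (v : ℤ × ℤ × ℤ) →
        (v ∈Prel N i) ⇔
        (v ∈ ((+ 0 , + 0 , + 0) ∷ (-[1+ 0 ] , + 1 , + 0) ∷ (-[1+ 0 ] , + 0 , + 1)
               ∷ (+ 0 , -[1+ 0 ] , + 1) ∷ (+ 0 , + 1 , -[1+ 0 ]) ∷ [])))
    × (∀ (i : ℕ) → 2 ≤ i → AC N i ≡ 5)
    × (∀ (M : ℕ) → ∃[ n ] (M ≤ n × AC n ≡ 5))
corollary7p4 = relative-vectors , abelian-complexity , infinitely-often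
  where
  relative-vectors : ∀ i → 2 ≤ i → ∀ v → v ∈Prel N i ⇔ v ∈ S₅
  relative-vectors i 2≤i v =
    subst (λ S → v ∈Prel N i ⇔ v ∈ S) (realised-N i 2≤i) (Prel-exact (N i) witnesses (complete-N i 2≤i) v)
  abelian-complexity : ∀ i → 2 ≤ i → AC N i ≡ 5
  abelian-complexity i 2≤i =
    AC-exact (N i) witnesses (complete-N i 2≤i) (subst Unique (sym (realised-N i 2≤i)) S₅-distinct)
  infinitely-often : ∀ M → ∃[ n ] (M ≤ n × AC n ≡ 5)
  infinitely-often M = N (2 + M) , ≤-trans (m≤n+m M 2) (N-≥ (2 + M)) , abelian-complexity (2 + M) (s≤s (s≤s z≤n))
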